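{- For all $n\ge4$, $b_n<a_n$, where $b_n$ is the number of permutations of $[n]$ all of whose peaks and valleys are even, and $a_n$ is the number of permutations of $[n]$ all of whose peaks are odd and all of whose valleys are even.
   Context: For a permutation $\pi=\pi_1\cdots\pi_n$, an index $i$ ($2\le i\le n-1$) is a peak if $\pi_{i-1}<\pi_i>\pi_{i+1}$ and a valley if $\pi_{i-1}>\pi_i<\pi_{i+1}$. -}

module Defs where

open import Data.Nat using (ℕ; zero; suc; _≤_; _<_; _∸_)
open import Data.Nat.Divisibility using (_∣_)
open import Data.List using (List; []; _∷_; length; map; upTo)
open import Data.List.Relation.Unary.Unique.Propositional using (Unique)
open import Data.List.Membership.Propositional using (_∈_)
open import Data.List.Relation.Binary.Permutation.Propositional using (_↭_)
open import Data.Product using (Σ; _×_)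
open import Relation.Nullary using (¬_)
open import Relation.Binary.PropositionalEquality using (_≡_)
open import Function.Bundles using (_⇔_)

[_] : ℕ → List ℕ
[ n ] = map suc (upTo n)

IsPerm : ℕ → List ℕ → Set
IsPerm n π = π ↭ [ n ]

-- π_i for 1-based index i (0 outside the range 1..length π; never used there)
_at_ : List ℕ → ℕ → ℕ
[] at _ = 0
(x ∷ xs) at zero = 0
(x ∷ xs) at suc zero = x
(x ∷ xs) at suc (suc i) = xs at suc i

IsPeak : List ℕ → ℕ → Set
IsPeak π i = 2 ≤ i × i ≤ length π ∸ 1 × π at (i ∸ 1) < π at i × π at suc i < π at i

IsValley : List ℕ → ℕ → Set
IsValley π i = 2 ≤ i × i ≤ length π ∸ 1 × π at i < π at (i ∸ 1) × π at i < π at suc i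

Even Odd : ℕ → Set
Even i = 2 ∣ i
Odd i = ¬ (2 ∣ i)

PeaksValleysEven : List ℕ → Set
PeaksValleysEven π = (∀ i → IsPeak π i → Even i) × (∀ i → IsValley π i → Even i)

PeaksOddValleysEven : List ℕ → Set
PeaksOddValleysEven π = (∀ i → IsPeak π i → Odd i) × (∀ i → IsValley π i → Even i)

HasCard : {A : Set} → (A → Set) → ℕ → Set
HasCard {A} P k = Σ (List A) λ xs → Unique xs × (∀ x → (x ∈ xs) ⇔ P x) × length xs ≡ k

Is-b : ℕ → ℕ → Set
Is-b n k = HasCard (λ π → IsPerm n π × PeaksValleysEven π) k

Is-a : ℕ → ℕ → Set
Is-a n k = HasCard (λ π → IsPerm n π × PeaksOddValleysEven π) k

-- If an even index i is a peak of π ∈ B_n and i + 1 < n, then i + 1, being odd, is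
-- neither peak nor valley, so π_{i-1} < π_i > π_{i+1} > π_{i+2}; swapping π_i and
-- π_{i+1} turns the even peak into an odd peak and creates no even peak or odd
-- valley. Doing this at every even peak maps B_n into A_n, and the map is undone by
-- swapping back in front of the odd peaks. At an even peak i = n - 1 that swap would
-- leave no trace, the peak becoming the last entry, so there π_{n-2} and π_{n-1} are
-- swapped instead; the decoder tells this from an ordinary swap by comparing the
-- entries around the new odd peak. Finally 4 2 3 1 5 ⋯ n lies in A_n outside the
-- image: an odd peak at index 3 of an encoded permutation either comes from a swap,
-- and then exceeds the first entry, or is followed by an entry that is not the
-- minimum.

module Submission where

open import Defs
open import Data.List
  using (List; []; _∷_; _++_; length; map; filter; concatMap; deduplicate; drop; head)
open import Data.List.Properties using (≡-dec; ∷-injective; length-map; map-∘; map-id-local)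
open import Data.List.Membership.Propositional using (_∈_; _∉_; find; lose)
open import Data.List.Membership.Propositional.Properties
  using (∈-map⁺; ∈-map⁻; ∈-concatMap⁺; ∈-concatMap⁻; ∈-∃++; ∈-++⁺ˡ; ∈-++⁺ʳ; ∈-++⁻;
         ∈-filter⁺; ∈-filter⁻; ∈-deduplicate⁺; ∈-deduplicate⁻)
open import Data.List.Relation.Binary.Permutation.Propositional
  using (_↭_; ↭-refl; ↭-sym; ↭-trans; ↭-prep; ↭-swap; ↭⇒↭ₛ)
open import Data.List.Relation.Binary.Permutation.Propositional.Properties
  using (↭-empty-inv; ∈-resp-↭; ↭-length; shift; drop-mid)
import Data.List.Relation.Binary.Permutation.Setoid.Properties as Setoid↭
open import Data.List.Relation.Binary.Subset.Propositional using (_⊆_)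
open import Data.List.Relation.Unary.All as All using (All; []; _∷_)
open import Data.List.Relation.Unary.All.Properties using (All¬⇒¬Any)
open import Data.List.Relation.Unary.AllPairs as AllPairs using (AllPairs; []; _∷_)
import Data.List.Relation.Unary.AllPairs.Properties as AllPairs
open import Data.List.Relation.Unary.Any as Any using (Any; here; there)
open import Data.List.Relation.Unary.Unique.Propositional using (Unique)
open import Data.List.Relation.Unary.Unique.Propositional.Properties using (map⁻; filter⁺)
open import Data.List.Relation.Unary.Unique.DecPropositional.Properties using (deduplicate-!)
open import Data.Maybe using (just)
open import Data.Maybe.Properties using (just-injective)
open import Data.Nat
  using (ℕ; zero; suc; _+_; _≤_; _<_; _∸_; _%_; _≟_; z≤n; s≤s; z<s; s<s)
open import Data.Nat.Divisibility using (_∣?_; n∣m⇒m%n≡0; m%n≡0⇒n∣m)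
open import Data.Nat.Properties
  using (_<?_; <-cmp; <-asym; <-trans; <⇒≢; m≤n⇒∃[o]m+o≡n; module ≤-Reasoning)
open import Data.Product as Product using (Σ; _×_; _,_; proj₁; map₁)
open import Data.Sum using (_⊎_; inj₁; inj₂)
open import Data.Unit using (⊤; tt)
open import Function using (_∘_; id)
open import Function.Bundles using (_⇔_; mk⇔; Equivalence)
open import Relation.Binary.Definitions using (tri<; tri≈; tri>)
open import Relation.Binary.PropositionalEquality
  using (_≡_; _≢_; refl; sym; trans; cong; subst; setoid; module ≡-Reasoning)
open import Relation.Nullary using (¬_; Dec; yes; no; contradiction)
open import Relation.Nullary.Decidable using (_×-dec_; _→-dec_; ¬?; map′)
open import Relation.Unary using (Decidable)

open Equivalence using (to; from)


-- Counting by injections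

unique-⊆⇒length≤ : ∀ {A : Set} {xs ys : List A} → Unique xs → xs ⊆ ys → length xs ≤ length ys
unique-⊆⇒length≤ {xs = []} _ _ = z≤n
unique-⊆⇒length≤ {xs = x ∷ xs} (x∉xs ∷ xs!) xs⊆ys with ∈-∃++ (xs⊆ys (here refl))
... | L , R , refl = begin
  suc (length xs)        ≤⟨ s≤s (unique-⊆⇒length≤ xs! xs⊆LR) ⟩
  suc (length (L ++ R))  ≡⟨ ↭-length (shift x L R) ⟨
  length (L ++ x ∷ R)    ∎
  where
  open ≤-Reasoning
  xs⊆LR : xs ⊆ L ++ R
  xs⊆LR {z} z∈xs with ∈-++⁻ L (xs⊆ys (there z∈xs))
  ... | inj₁ z∈L         = ∈-++⁺ˡ z∈L
  ... | inj₂ (here refl) = contradiction z∈xs (All¬⇒¬Any x∉xs)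
  ... | inj₂ (there z∈R) = ∈-++⁺ʳ L z∈R

length-<-retraction : ∀ {A B : Set} (f : A → B) (g : B → A) {xs : List A} {ys : List B} {y : B} →
  Unique xs → (∀ {x} → x ∈ xs → g (f x) ≡ x) → (∀ {x} → x ∈ xs → f x ∈ ys) →
  y ∈ ys → (∀ {x} → x ∈ xs → f x ≢ y) → length xs < length ys
length-<-retraction f g {xs} {ys} {y} xs! gf≡id f∈ys y∈ys f≢y =
  subst (_< length ys) (length-map f xs) (unique-⊆⇒length≤ (y∉fxs ∷ fxs!) y∷fxs⊆ys)
  where
  gfxs≡xs : map g (map f xs) ≡ xs
  gfxs≡xs = trans (sym (map-∘ xs)) (map-id-local (All.tabulate gf≡id))
  fxs! : Unique (map f xs)
  fxs! = map⁻ {f = g} (subst Unique (sym gfxs≡xs) xs!)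
  y∉fxs : All (y ≢_) (map f xs)
  y∉fxs = All.tabulate λ z∈ y≡z →
    let x , x∈ , z≡fx = ∈-map⁻ f z∈ in f≢y x∈ (sym (trans y≡z z≡fx))
  y∷fxs⊆ys : y ∷ map f xs ⊆ ys
  y∷fxs⊆ys (here refl) = y∈ys
  y∷fxs⊆ys (there z∈) with ∈-map⁻ f z∈
  ... | _ , x∈ , refl = f∈ys x∈

-- Enumerating permutations

insertions : ∀ {A : Set} → A → List A → List (List A)
insertions x []       = (x ∷ []) ∷ []
insertions x (y ∷ ys) = (x ∷ y ∷ ys) ∷ map (y ∷_) (insertions x ys)

permutations : ∀ {A : Set} → List A → List (List A)
permutations []       = [] ∷ []
permutations (x ∷ xs) = concatMap (insertions x) (permutations xs)

∈-insertions⁻ : ∀ {A : Set} {x : A} ys {σ} → σ ∈ insertions x ys → σ ↭ x ∷ ys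
∈-insertions⁻ []       (here refl) = ↭-refl
∈-insertions⁻ (y ∷ ys) (here refl) = ↭-refl
∈-insertions⁻ {x = x} (y ∷ ys) (there σ∈) with ∈-map⁻ (y ∷_) σ∈
... | _ , τ∈ , refl = ↭-trans (↭-prep y (∈-insertions⁻ ys τ∈)) (↭-swap y x ↭-refl)

∈-insertions⁺ : ∀ {A : Set} {x : A} L R → L ++ x ∷ R ∈ insertions x (L ++ R)
∈-insertions⁺ []      []      = here refl
∈-insertions⁺ []      (_ ∷ _) = here refl
∈-insertions⁺ (l ∷ L) R       = there (∈-map⁺ (l ∷_) (∈-insertions⁺ L R))

∈-permutations : ∀ {A : Set} (xs : List A) π → π ∈ permutations xs ⇔ (π ↭ xs)
∈-permutations xs π = mk⇔ (sound xs) (complete xs)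
  where
  sound : ∀ xs {π} → π ∈ permutations xs → π ↭ xs
  sound []       (here refl) = ↭-refl
  sound (x ∷ xs) π∈ with find (∈-concatMap⁻ (insertions x) {xs = permutations xs} π∈)
  ... | τ , τ∈ , π∈ins = ↭-trans (∈-insertions⁻ τ π∈ins) (↭-prep x (sound xs τ∈))

  complete : ∀ xs {π} → π ↭ xs → π ∈ permutations xs
  complete []       π↭ rewrite ↭-empty-inv π↭ = here refl
  complete (x ∷ xs) π↭ with ∈-∃++ (∈-resp-↭ (↭-sym π↭) (here refl))
  ... | L , R , refl =
    ∈-concatMap⁺ (insertions x) (lose (complete xs (drop-mid L [] π↭)) (∈-insertions⁺ L R))

Perms : ℕ → List (List ℕ)
Perms n = deduplicate (≡-dec _≟_) (permutations [ n ])

PermsWith : ∀ {P : List ℕ → Set} → Decidable P → ℕ → List (List ℕ)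
PermsWith P? n = filter P? (Perms n)

∈-PermsWith : ∀ {P} (P? : Decidable P) n π → π ∈ PermsWith P? n ⇔ (IsPerm n π × P π)
∈-PermsWith P? n π = mk⇔
  (map₁ (to (∈-permutations [ n ] π) ∘ ∈-deduplicate⁻ _ (permutations [ n ])) ∘ ∈-filter⁻ P?)
  (λ (π↭ , p) → ∈-filter⁺ P? (∈-deduplicate⁺ _ (from (∈-permutations [ n ] π) π↭)) p)

PermsWith-unique : ∀ {P} (P? : Decidable P) n → Unique (PermsWith P? n)
PermsWith-unique P? n = filter⁺ P? (deduplicate-! (≡-dec _≟_) (permutations [ n ]))

hasCard-PermsWith : ∀ {P} (P? : Decidable P) n →
  HasCard (λ π → IsPerm n π × P π) (length (PermsWith P? n))
hasCard-PermsWith P? n = PermsWith P? n , PermsWith-unique P? n , ∈-PermsWith P? n , refl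

[n]-ascending : ∀ n → AllPairs _<_ [ n ]
[n]-ascending n = AllPairs.map⁺ (AllPairs.applyUpTo⁺₁ id n λ i<j _ → s<s i<j)

perm-unique : ∀ {n π} → IsPerm n π → Unique π
perm-unique π↭ =
  Setoid↭.Unique-resp-↭ (setoid ℕ) (↭⇒↭ₛ (↭-sym π↭)) (AllPairs.map <⇒≢ ([n]-ascending _))

perm-0∉ : ∀ {n π} → IsPerm n π → 0 ∉ π
perm-0∉ π↭ 0∈π with ∈-map⁻ suc (∈-resp-↭ π↭ 0∈π)
... | _ , _ , ()

Peak Valley Through : ℕ → ℕ → ℕ → Set
Peak x y z = x < y × z < y
Valley x y z = y < x × y < z
Through x y z = (x < y × y < z) ⊎ (z < y × y < x)

peak? : ∀ x y z → Dec (Peak x y z)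
peak? x y z = (x <? y) ×-dec (z <? y)

valley? : ∀ x y z → Dec (Valley x y z)
valley? x y z = (y <? x) ×-dec (y <? z)

through : ∀ {x y z} → x ≢ y → y ≢ z → ¬ Peak x y z → ¬ Valley x y z → Through x y z
through {x} {y} {z} x≢y y≢z ¬pk ¬vl with <-cmp x y | <-cmp y z
... | tri≈ _ x≡y _ | _            = contradiction x≡y x≢y
... | _            | tri≈ _ y≡z _ = contradiction y≡z y≢z
... | tri< x<y _ _ | tri< y<z _ _ = inj₁ (x<y , y<z)
... | tri< x<y _ _ | tri> _ _ z<y = contradiction (x<y , z<y) ¬pk
... | tri> _ _ y<x | tri< y<z _ _ = contradiction (y<x , y<z) ¬vl
... | tri> _ _ y<x | tri> _ _ z<y = inj₂ (z<y , y<x)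

through⇒¬peak : ∀ {x y z} → Through x y z → ¬ Peak x y z
through⇒¬peak (inj₁ (_ , y<z)) (_ , z<y) = <-asym y<z z<y
through⇒¬peak (inj₂ (_ , y<x)) (x<y , _) = <-asym y<x x<y

through⇒¬valley : ∀ {x y z} → Through x y z → ¬ Valley x y z
through⇒¬valley (inj₁ (x<y , _)) (y<x , _) = <-asym y<x x<y
through⇒¬valley (inj₂ (z<y , _)) (_ , y<z) = <-asym y<z z<y

through-ascending : ∀ {x y z} → Through x y z → y < z → x < y
through-ascending (inj₁ (x<y , _)) _   = x<y
through-ascending (inj₂ (z<y , _)) y<z = contradiction z<y (<-asym y<z)

through-descending : ∀ {x y z} → Through x y z → y < x → z < y
through-descending (inj₁ (x<y , _)) y<x = contradiction x<y (<-asym y<x)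
through-descending (inj₂ (z<y , _)) _   = z<y

ascent⇒¬peak : ∀ {w x y} → x < y → ¬ Peak w x y
ascent⇒¬peak x<y (_ , y<x) = <-asym x<y y<x

ascent⇒¬valley : ∀ {x y z} → x < y → ¬ Valley x y z
ascent⇒¬valley x<y (y<x , _) = <-asym x<y y<x

descent⇒¬peak : ∀ {x y z} → y < x → ¬ Peak x y z
descent⇒¬peak y<x (x<y , _) = <-asym x<y y<x

¬peak-lower : ∀ {L′ L a b} → (L′ < a → L < a) → ¬ Peak L a b → ¬ Peak L′ a b
¬peak-lower L′<a⇒L<a ¬pk (L′<a , b<a) = ¬pk (L′<a⇒L<a L′<a , b<a)

-- IsPeak π i and IsValley π i unfold to Interior Peak π i and Interior Valley π i.
Interior : (ℕ → ℕ → ℕ → Set) → List ℕ → ℕ → Set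
Interior R π i = 2 ≤ i × i ≤ length π ∸ 1 × R (π at (i ∸ 1)) (π at i) (π at suc i)

InteriorIn : (ℕ → ℕ → ℕ → Set) → (ℕ → Set) → List ℕ → Set
InteriorIn R Q (x ∷ y ∷ z ∷ r) = (R x y z → Q 2) × InteriorIn R (Q ∘ suc) (y ∷ z ∷ r)
InteriorIn R Q _               = ⊤

interiorIn⇔ : ∀ R Q π → (∀ i → Interior R π i → Q i) ⇔ InteriorIn R Q π
interiorIn⇔ R Q π = mk⇔ (collect Q π) (spread Q π)
  where
  collect : ∀ Q π → (∀ i → Interior R π i → Q i) → InteriorIn R Q π
  collect Q (x ∷ y ∷ z ∷ r) h =
      (λ xyz → h 2 (s<s z<s , s<s z<s , xyz))
    , collect (Q ∘ suc) (y ∷ z ∷ r) λ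
        { (suc zero)    (s≤s () , _)
        ; (suc (suc i)) (_ , i≤ , yzw) → h (3 + i) (s<s z<s , s≤s i≤ , yzw) }
  collect Q []           _ = tt
  collect Q (_ ∷ [])     _ = tt
  collect Q (_ ∷ _ ∷ []) _ = tt

  spread : ∀ Q π → InteriorIn R Q π → ∀ i → Interior R π i → Q i
  spread Q (x ∷ y ∷ z ∷ r) (h , _)  2                   (_ , _ , xyz)       = h xyz
  spread Q (x ∷ y ∷ z ∷ r) (_ , hs) (suc (suc (suc i))) (_ , s≤s i≤ , yzw) =
    spread (Q ∘ suc) (y ∷ z ∷ r) hs (2 + i) (s<s z<s , i≤ , yzw)
  spread Q (_ ∷ _ ∷ []) _ (suc (suc i)) (_ , s≤s () , _)
  spread Q (_ ∷ [])     _ (suc (suc i)) (_ , () , _)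
  spread Q []           _ (suc (suc i)) (_ , () , _)
  spread Q π            _ (suc zero)    (s≤s () , _)

interiorIn? : ∀ {R Q} → (∀ x y z → Dec (R x y z)) → Decidable Q → Decidable (InteriorIn R Q)
interiorIn? R? Q? (x ∷ y ∷ z ∷ r) =
  (R? x y z →-dec Q? 2) ×-dec interiorIn? R? (Q? ∘ suc) (y ∷ z ∷ r)
interiorIn? R? Q? []           = yes tt
interiorIn? R? Q? (_ ∷ [])     = yes tt
interiorIn? R? Q? (_ ∷ _ ∷ []) = yes tt

peaksValleys? : ∀ {Qp Qv : ℕ → Set} → Decidable Qp → Decidable Qv →
  Decidable (λ π → (∀ i → IsPeak π i → Qp i) × (∀ i → IsValley π i → Qv i))
peaksValleys? Qp? Qv? π =
  map′ (Product.map (from (interiorIn⇔ Peak _ π)) (from (interiorIn⇔ Valley _ π)))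
       (Product.map (to (interiorIn⇔ Peak _ π)) (to (interiorIn⇔ Valley _ π)))
       (interiorIn? peak? Qp? π ×-dec interiorIn? valley? Qv? π)

peaksValleysEven? : Decidable PeaksValleysEven
peaksValleysEven? = peaksValleys? (2 ∣?_) (2 ∣?_)

peaksOddValleysEven? : Decidable PeaksOddValleysEven
peaksOddValleysEven? = peaksValleys? (¬? ∘ (2 ∣?_)) (2 ∣?_)

-- Parity by remainder, so that EvenIndex (2 + i) reduces to EvenIndex i.
EvenIndex OddIndex : ℕ → Set
EvenIndex i = i % 2 ≡ 0
OddIndex i = ¬ EvenIndex i

-- Conditions on the tail ys of x ∷ ys, whose head has the even index 2; in
-- NoEvenPeakNoOddValley L ys, L is the entry preceding the tail.
ThroughAtOdd : List ℕ → Set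
ThroughAtOdd (a ∷ b ∷ c ∷ r) = Through a b c × ThroughAtOdd (c ∷ r)
ThroughAtOdd _               = ⊤

NoEvenPeakNoOddValley : ℕ → List ℕ → Set
NoEvenPeakNoOddValley L (a ∷ b ∷ c ∷ r) =
  ¬ Peak L a b × ¬ Valley a b c × NoEvenPeakNoOddValley b (c ∷ r)
NoEvenPeakNoOddValley L (a ∷ b ∷ []) = ¬ Peak L a b
NoEvenPeakNoOddValley L _            = ⊤

interiorIn⇒throughAtOdd : ∀ x ys →
  InteriorIn Peak EvenIndex (x ∷ ys) → InteriorIn Valley EvenIndex (x ∷ ys) →
  Unique ys → ThroughAtOdd ys
interiorIn⇒throughAtOdd x (a ∷ b ∷ c ∷ r) (_ , p₃ , ps) (_ , v₃ , vs) ((a≢b ∷ _) ∷ (b≢c ∷ _) ∷ r!) =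
  through a≢b b≢c (three-odd ∘ p₃) (three-odd ∘ v₃) , interiorIn⇒throughAtOdd b (c ∷ r) ps vs r!
  where
  three-odd : ¬ EvenIndex 3
  three-odd ()
interiorIn⇒throughAtOdd x []           _ _ _ = tt
interiorIn⇒throughAtOdd x (_ ∷ [])     _ _ _ = tt
interiorIn⇒throughAtOdd x (_ ∷ _ ∷ []) _ _ _ = tt

peaksValleysEven⇒throughAtOdd : ∀ x ys → PeaksValleysEven (x ∷ ys) → Unique ys → ThroughAtOdd ys
peaksValleysEven⇒throughAtOdd x ys (p , v) = interiorIn⇒throughAtOdd x ys
  (to (interiorIn⇔ Peak EvenIndex _) λ i pk → n∣m⇒m%n≡0 i 2 (p i pk))
  (to (interiorIn⇔ Valley EvenIndex _) λ i vl → n∣m⇒m%n≡0 i 2 (v i vl))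

noEvenPeakNoOddValley⇒interiorIn : ∀ x ys → NoEvenPeakNoOddValley x ys →
  InteriorIn Peak OddIndex (x ∷ ys) × InteriorIn Valley EvenIndex (x ∷ ys)
noEvenPeakNoOddValley⇒interiorIn x (a ∷ b ∷ c ∷ r) (¬pk , ¬vl , h)
  with noEvenPeakNoOddValley⇒interiorIn b (c ∷ r) h
... | ps , vs = ((λ pk → contradiction pk ¬pk) , (λ _ ()) , ps)
              , ((λ _ → refl) , (λ vl → contradiction vl ¬vl) , vs)
noEvenPeakNoOddValley⇒interiorIn x (a ∷ b ∷ []) ¬pk =
  ((λ pk → contradiction pk ¬pk) , tt) , ((λ _ → refl) , tt)
noEvenPeakNoOddValley⇒interiorIn x []       _ = tt , tt
noEvenPeakNoOddValley⇒interiorIn x (_ ∷ []) _ = tt , tt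

noEvenPeakNoOddValley⇒peaksOddValleysEven : ∀ x ys →
  NoEvenPeakNoOddValley x ys → PeaksOddValleysEven (x ∷ ys)
noEvenPeakNoOddValley⇒peaksOddValleysEven x ys h with noEvenPeakNoOddValley⇒interiorIn x ys h
... | ps , vs =
    (λ i pk 2∣i → from (interiorIn⇔ Peak OddIndex _) ps i pk (n∣m⇒m%n≡0 i 2 2∣i))
  , (λ i vl → m%n≡0⇒n∣m i 2 (from (interiorIn⇔ Valley EvenIndex _) vs i vl))

ascending⇒noEvenPeakNoOddValley : ∀ L xs → AllPairs _<_ xs → NoEvenPeakNoOddValley L xs
ascending⇒noEvenPeakNoOddValley L (a ∷ b ∷ c ∷ r) ((a<b ∷ _) ∷ _ ∷ asc) =
  ascent⇒¬peak a<b , ascent⇒¬valley a<b , ascending⇒noEvenPeakNoOddValley b (c ∷ r) asc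
ascending⇒noEvenPeakNoOddValley L (a ∷ b ∷ []) ((a<b ∷ _) ∷ _) = ascent⇒¬peak a<b
ascending⇒noEvenPeakNoOddValley L []       _ = tt
ascending⇒noEvenPeakNoOddValley L (_ ∷ []) _ = tt

-- The encoding from B_n to A_n

swapIf : ∀ {P : Set} → Dec P → ℕ → ℕ → List ℕ → List ℕ
swapIf (yes _) a b t = b ∷ a ∷ t
swapIf (no _)  a b t = a ∷ b ∷ t

-- L is the entry before the tail; the first clause makes the exceptional swap at the end.
encodeTail : ℕ → List ℕ → List ℕ
encodeTail L (a ∷ b ∷ c ∷ d ∷ []) with peak? b c d
... | yes _ = a ∷ c ∷ b ∷ d ∷ []
... | no _  = swapIf (peak? L a b) a b (c ∷ d ∷ [])
encodeTail L (a ∷ b ∷ c ∷ t) = swapIf (peak? L a b) a b (encodeTail b (c ∷ t))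
encodeTail L ys = ys

encode : List ℕ → List ℕ
encode []       = []
encode (x ∷ ys) = x ∷ encodeTail x ys

swapIf-↭ : ∀ {P : Set} (p : Dec P) a b {t t′} → t ↭ t′ → swapIf p a b t ↭ a ∷ b ∷ t′
swapIf-↭ (yes _) a b t↭ = ↭-swap b a t↭
swapIf-↭ (no _)  a b t↭ = ↭-prep a (↭-prep b t↭)

encodeTail-↭ : ∀ L ys → encodeTail L ys ↭ ys
encodeTail-↭ L (a ∷ b ∷ c ∷ d ∷ []) with peak? b c d
... | yes _ = ↭-prep a (↭-swap c b ↭-refl)
... | no _  = swapIf-↭ (peak? L a b) a b ↭-refl
encodeTail-↭ L (a ∷ b ∷ c ∷ [])        = swapIf-↭ (peak? L a b) a b ↭-refl
encodeTail-↭ L (a ∷ b ∷ c ∷ d ∷ e ∷ r) =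
  swapIf-↭ (peak? L a b) a b (encodeTail-↭ b (c ∷ d ∷ e ∷ r))
encodeTail-↭ L []           = ↭-refl
encodeTail-↭ L (_ ∷ [])     = ↭-refl
encodeTail-↭ L (_ ∷ _ ∷ []) = ↭-refl

encode-↭ : ∀ π → encode π ↭ π
encode-↭ []       = ↭-refl
encode-↭ (x ∷ ys) = ↭-prep x (encodeTail-↭ x ys)

head-swapIf : ∀ {L c d} (p : Dec (Peak L c d)) t →
  head (swapIf p c d t) ≡ just c ⊎ Peak L c d × head (swapIf p c d t) ≡ just d
head-swapIf (yes pk) t = inj₂ (pk , refl)
head-swapIf (no _)   t = inj₁ refl

head-encodeTail : ∀ L c d t →
  head (encodeTail L (c ∷ d ∷ t)) ≡ just c ⊎ Peak L c d × head (encodeTail L (c ∷ d ∷ t)) ≡ just d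
head-encodeTail L c d []       = inj₁ refl
head-encodeTail L c d (e ∷ []) = head-swapIf (peak? L c d) (e ∷ [])
head-encodeTail L c d (e ∷ f ∷ []) with peak? d e f
... | yes _ = inj₁ refl
... | no _  = head-swapIf (peak? L c d) (e ∷ f ∷ [])
head-encodeTail L c d (e ∷ f ∷ g ∷ r) = head-swapIf (peak? L c d) (encodeTail d (e ∷ f ∷ g ∷ r))

noEvenPeakNoOddValley-∷∷ : ∀ {L a b} E → ¬ Peak L a b →
  (∀ {c} → head E ≡ just c → ¬ Valley a b c) →
  NoEvenPeakNoOddValley b E → NoEvenPeakNoOddValley L (a ∷ b ∷ E)
noEvenPeakNoOddValley-∷∷ []      ¬pk _   _ = ¬pk
noEvenPeakNoOddValley-∷∷ (c ∷ t) ¬pk ¬vl h = ¬pk , ¬vl refl , h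

-- L is the original predecessor of the tail, which decides the swaps; L′ is its
-- predecessor after encoding, differing from L only after a swap.
encodeTail-noEvenPeakNoOddValley : ∀ {L′} L a b c t → (L′ < a → L < a) →
  ThroughAtOdd (a ∷ b ∷ c ∷ t) → NoEvenPeakNoOddValley L′ (encodeTail L (a ∷ b ∷ c ∷ t))
encodeTail-noEvenPeakNoOddValley L a b c [] lower (th , _) with peak? L a b
... | yes (_ , b<a) = ascent⇒¬peak b<a , ascent⇒¬valley b<a , tt
... | no ¬pk        = ¬peak-lower lower ¬pk , through⇒¬valley th , tt
encodeTail-noEvenPeakNoOddValley L a b c (d ∷ []) lower (th , _) with peak? b c d
... | yes (b<c , _) = ascent⇒¬peak a<c , ascent⇒¬valley a<c , descent⇒¬peak b<c
  where
  a<c : a < c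
  a<c = <-trans (through-ascending th b<c) b<c
... | no ¬pk₄ with peak? L a b
...   | yes (_ , b<a) = ascent⇒¬peak b<a , ascent⇒¬valley b<a , descent⇒¬peak c<a
  where
  c<a : c < a
  c<a = <-trans (through-descending th b<a) b<a
...   | no ¬pk = ¬peak-lower lower ¬pk , through⇒¬valley th , ¬pk₄
encodeTail-noEvenPeakNoOddValley L a b c (d ∷ e ∷ r) lower (th , ths) with peak? L a b
... | yes (_ , b<a) = noEvenPeakNoOddValley-∷∷ (encodeTail b (c ∷ d ∷ e ∷ r))
  (ascent⇒¬peak b<a) (λ _ → ascent⇒¬valley b<a)
  (encodeTail-noEvenPeakNoOddValley b c d e r (λ a<c → contradiction a<c (<-asym c<a)) ths)
  where
  c<a : c < a
  c<a = <-trans (through-descending th b<a) b<a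
... | no ¬pk = noEvenPeakNoOddValley-∷∷ (encodeTail b (c ∷ d ∷ e ∷ r))
  (¬peak-lower lower ¬pk) ¬valley (encodeTail-noEvenPeakNoOddValley b c d e r id ths)
  where
  ¬valley : ∀ {x} → head (encodeTail b (c ∷ d ∷ e ∷ r)) ≡ just x → ¬ Valley a b x
  ¬valley {x} hd≡x (b<a , b<x) with head-encodeTail b c d (e ∷ r)
  ... | inj₁ hd≡c            = <-asym c<b (subst (b <_) x≡c b<x)
    where
    c<b : c < b
    c<b = through-descending th b<a
    x≡c : x ≡ c
    x≡c = just-injective (trans (sym hd≡x) hd≡c)
  ... | inj₂ ((b<c , _) , _) = <-asym b<c (through-descending th b<a)

decodeStep : List ℕ → List ℕ
decodeStep (x ∷ y ∷ z ∷ t) = swapIf (peak? x y z) x y (z ∷ t)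
decodeStep s               = s

-- The exceptional swap turns a b c d with a < b < c into a c b d, an ordinary one
-- turns a b c d with c < b < a into b a c d; only the former has its first entry
-- below its third.
decodeTail : List ℕ → List ℕ
decodeTail (a ∷ b ∷ c ∷ d ∷ []) with peak? a b c ×-dec a <? c
... | yes _ = a ∷ c ∷ b ∷ d ∷ []
... | no _  = decodeStep (a ∷ b ∷ c ∷ d ∷ [])
decodeTail (a ∷ b ∷ c ∷ t) = decodeStep (a ∷ b ∷ decodeTail (c ∷ t))
decodeTail s = s

decode : List ℕ → List ℕ
decode []       = []
decode (x ∷ ys) = x ∷ decodeTail ys

decodeTail-∷∷ : ∀ x y s → length s ≢ 2 →
  decodeTail (x ∷ y ∷ s) ≡ decodeStep (x ∷ y ∷ decodeTail s)
decodeTail-∷∷ x y []              _  = refl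
decodeTail-∷∷ x y (_ ∷ [])        _  = refl
decodeTail-∷∷ x y (_ ∷ _ ∷ [])    ≢2 = contradiction refl ≢2
decodeTail-∷∷ x y (_ ∷ _ ∷ _ ∷ _) _  = refl

decodeTail-swapIf : ∀ {P : Set} (p : Dec P) a b s → length s ≢ 2 →
  decodeTail (swapIf p a b s) ≡ decodeStep (swapIf p a b (decodeTail s))
decodeTail-swapIf (yes _) a b s = decodeTail-∷∷ b a s
decodeTail-swapIf (no _)  a b s = decodeTail-∷∷ a b s

decodeStep-swapIf : ∀ {L a b c} (p : Dec (Peak L a b)) t → Through a b c →
  decodeStep (swapIf p a b (c ∷ t)) ≡ a ∷ b ∷ c ∷ t
decodeStep-swapIf {a = a} {b} {c} (yes (_ , b<a)) t th with peak? b a c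
... | yes _  = refl
... | no ¬pk = contradiction (b<a , <-trans (through-descending th b<a) b<a) ¬pk
decodeStep-swapIf {a = a} {b} {c} (no _) t th with peak? a b c
... | yes pk = contradiction pk (through⇒¬peak th)
... | no _   = refl

decodeTail-endSwap : ∀ {a b c} d → a < b → b < c →
  decodeTail (a ∷ c ∷ b ∷ d ∷ []) ≡ a ∷ b ∷ c ∷ d ∷ []
decodeTail-endSwap {a} {b} {c} d a<b b<c with peak? a c b ×-dec a <? b
... | yes _   = refl
... | no ¬end = contradiction ((<-trans a<b b<c , b<c) , a<b) ¬end

decodeTail-noEndSwap : ∀ {L a b c} (p : Dec (Peak L a b)) d → Through a b c →
  decodeTail (swapIf p a b (c ∷ d ∷ [])) ≡ decodeStep (swapIf p a b (c ∷ d ∷ []))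
decodeTail-noEndSwap {a = a} {b} {c} (yes (_ , b<a)) d th with peak? b a c ×-dec b <? c
... | yes (_ , b<c) = contradiction b<c (<-asym (through-descending th b<a))
... | no _          = refl
decodeTail-noEndSwap {a = a} {b} {c} (no _) d th with peak? a b c ×-dec a <? c
... | yes (pk , _) = contradiction pk (through⇒¬peak th)
... | no _         = refl

decodeTail-encodeTail : ∀ L ys → ThroughAtOdd ys → decodeTail (encodeTail L ys) ≡ ys
decodeTail-encodeTail L (a ∷ b ∷ c ∷ d ∷ []) (th , _) with peak? b c d
... | yes (b<c , _) = decodeTail-endSwap d (through-ascending th b<c) b<c
... | no _          = trans (decodeTail-noEndSwap (peak? L a b) d th)
                            (decodeStep-swapIf (peak? L a b) (d ∷ []) th)
decodeTail-encodeTail L (a ∷ b ∷ c ∷ []) (th , _) =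
  trans (decodeTail-swapIf (peak? L a b) a b (c ∷ []) λ ()) (decodeStep-swapIf (peak? L a b) [] th)
decodeTail-encodeTail L (a ∷ b ∷ c ∷ d ∷ e ∷ r) (th , ths) = begin
  decodeTail (swapIf p a b E)
    ≡⟨ decodeTail-swapIf p a b E length-E≢2 ⟩
  decodeStep (swapIf p a b (decodeTail E))
    ≡⟨ cong (decodeStep ∘ swapIf p a b) (decodeTail-encodeTail b _ ths) ⟩
  decodeStep (swapIf p a b (c ∷ d ∷ e ∷ r))
    ≡⟨ decodeStep-swapIf p (d ∷ e ∷ r) th ⟩
  a ∷ b ∷ c ∷ d ∷ e ∷ r
    ∎
  where
  open ≡-Reasoning
  p : Dec (Peak L a b)
  p = peak? L a b
  E : List ℕ
  E = encodeTail b (c ∷ d ∷ e ∷ r)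
  length-E≢2 : length E ≢ 2
  length-E≢2 rewrite ↭-length (encodeTail-↭ b (c ∷ d ∷ e ∷ r)) = λ ()
decodeTail-encodeTail L []           _ = refl
decodeTail-encodeTail L (_ ∷ [])     _ = refl
decodeTail-encodeTail L (_ ∷ _ ∷ []) _ = refl

-- A permutation in A_n outside the image

encodeTail-leadingPeak : ∀ L ys {p q s σ} → ThroughAtOdd ys →
  encodeTail L ys ≡ p ∷ q ∷ s ∷ σ → Peak p q s → L < q ⊎ Any (_< s) ys
encodeTail-leadingPeak L (a ∷ b ∷ c ∷ []) (th , _) eq pk with peak? L a b
encodeTail-leadingPeak L (a ∷ b ∷ c ∷ []) (th , _) refl _  | yes (L<a , _) = inj₁ L<a
encodeTail-leadingPeak L (a ∷ b ∷ c ∷ []) (th , _) refl pk | no _ =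
  contradiction pk (through⇒¬peak th)
encodeTail-leadingPeak L (a ∷ b ∷ c ∷ d ∷ []) (th , _) eq pk with peak? b c d
encodeTail-leadingPeak L (a ∷ b ∷ c ∷ d ∷ []) (th , _) refl _ | yes (b<c , _) =
  inj₂ (here (through-ascending th b<c))
encodeTail-leadingPeak L (a ∷ b ∷ c ∷ d ∷ []) (th , _) eq pk | no _ with peak? L a b
encodeTail-leadingPeak L (a ∷ b ∷ c ∷ d ∷ []) (th , _) refl _  | no _ | yes (L<a , _) = inj₁ L<a
encodeTail-leadingPeak L (a ∷ b ∷ c ∷ d ∷ []) (th , _) refl pk | no _ | no _ =
  contradiction pk (through⇒¬peak th)
encodeTail-leadingPeak L (a ∷ b ∷ c ∷ d ∷ e ∷ r) (th , th′ , _) eq pk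
  with peak? L a b | encodeTail b (c ∷ d ∷ e ∷ r) | head-encodeTail b c d (e ∷ r)
encodeTail-leadingPeak L (a ∷ b ∷ c ∷ d ∷ e ∷ r) (th , th′ , _) refl _  | yes (L<a , _) | _ | _ =
  inj₁ L<a
encodeTail-leadingPeak L (a ∷ b ∷ c ∷ d ∷ e ∷ r) (th , th′ , _) refl pk | no _ | _ | inj₁ refl =
  contradiction pk (through⇒¬peak th)
encodeTail-leadingPeak L (a ∷ b ∷ c ∷ d ∷ e ∷ r) (th , th′ , _) refl _
  | no _ | _ | inj₂ ((_ , d<c) , refl) = inj₂ (there (there (there (there (here e<d)))))
  where
  e<d : e < d
  e<d = through-descending th′ d<c
encodeTail-leadingPeak L []           _ () _
encodeTail-leadingPeak L (_ ∷ [])     _ () _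
encodeTail-leadingPeak L (_ ∷ _ ∷ []) _ () _

witness : ℕ → List ℕ
witness n = 4 ∷ 2 ∷ 3 ∷ 1 ∷ drop 4 [ n ]

witness-perm : ∀ m → IsPerm (4 + m) (witness (4 + m))
witness-perm m = ↭-trans (↭-sym (shift 4 (2 ∷ 3 ∷ 1 ∷ []) T)) (shift 1 (2 ∷ 3 ∷ []) (4 ∷ T))
  where
  T : List ℕ
  T = drop 4 [ 4 + m ]

witness-peaksOddValleysEven : ∀ m → PeaksOddValleysEven (witness (4 + m))
witness-peaksOddValleysEven m with [n]-ascending (4 + m)
... | (_ ∷ _ ∷ _ ∷ 1<T) ∷ _ ∷ _ ∷ _ ∷ T↑ = noEvenPeakNoOddValley⇒peaksOddValleysEven 4 _
  ( descent⇒¬peak (s<s (s<s z<s))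
  , ascent⇒¬valley (s<s (s<s z<s))
  , ascending⇒noEvenPeakNoOddValley 3 _ (1<T ∷ T↑))

Bperms Aperms : ℕ → List (List ℕ)
Bperms = PermsWith peaksValleysEven?
Aperms = PermsWith peaksOddValleysEven?

∈-Bperms⇒throughAtOdd : ∀ n {x ys} → x ∷ ys ∈ Bperms n → ThroughAtOdd ys
∈-Bperms⇒throughAtOdd n {x} {ys} π∈ with to (∈-PermsWith _ n (x ∷ ys)) π∈
... | π↭ , pv with perm-unique π↭
...   | _ ∷ ys! = peaksValleysEven⇒throughAtOdd x ys pv ys!

decode-encode : ∀ n {π} → π ∈ Bperms n → decode (encode π) ≡ π
decode-encode n {[]}     _  = refl
decode-encode n {x ∷ ys} π∈ =
  cong (x ∷_) (decodeTail-encodeTail x ys (∈-Bperms⇒throughAtOdd n π∈))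

encode-∈-Aperms : ∀ m {π} → π ∈ Bperms (4 + m) → encode π ∈ Aperms (4 + m)
encode-∈-Aperms m {π} π∈ with to (∈-PermsWith _ (4 + m) π) π∈
... | π↭ , _ = from (∈-PermsWith _ (4 + m) (encode π))
  (↭-trans (encode-↭ π) π↭ , peaksOddValleysEven-encode π (↭-length π↭) π∈)
  where
  peaksOddValleysEven-encode : ∀ π → length π ≡ length [ 4 + m ] → π ∈ Bperms (4 + m) →
    PeaksOddValleysEven (encode π)
  peaksOddValleysEven-encode (x ∷ a ∷ b ∷ c ∷ t) _ π∈ =
    noEvenPeakNoOddValley⇒peaksOddValleysEven x _
      (encodeTail-noEvenPeakNoOddValley x a b c t id (∈-Bperms⇒throughAtOdd (4 + m) π∈))
  peaksOddValleysEven-encode []               ()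
  peaksOddValleysEven-encode (_ ∷ [])         ()
  peaksOddValleysEven-encode (_ ∷ _ ∷ [])     ()
  peaksOddValleysEven-encode (_ ∷ _ ∷ _ ∷ []) ()

witness-∈-Aperms : ∀ m → witness (4 + m) ∈ Aperms (4 + m)
witness-∈-Aperms m =
  from (∈-PermsWith _ (4 + m) _) (witness-perm m , witness-peaksOddValleysEven m)

encode≢witness : ∀ n {π} → π ∈ Bperms n → encode π ≢ witness n
encode≢witness n {x ∷ ys} π∈ eq with ∷-injective eq
... | refl , eq′
  with encodeTail-leadingPeak 4 ys (∈-Bperms⇒throughAtOdd n π∈) eq′ (s<s (s<s z<s) , s<s z<s)
...   | inj₁ (s<s (s<s (s<s ())))
...   | inj₂ below-1 =
  perm-0∉ (proj₁ (to (∈-PermsWith _ n _) π∈)) (there (Any.map (λ { z<s → refl }) below-1))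

proposition8 : (n : ℕ) → 4 ≤ n →
    Σ ℕ λ b → Σ ℕ λ a → Is-b n b × Is-a n a × b < a
proposition8 n 4≤n with m≤n⇒∃[o]m+o≡n 4≤n
... | m , refl =
    length (Bperms (4 + m)) , length (Aperms (4 + m))
  , hasCard-PermsWith peaksValleysEven? (4 + m) , hasCard-PermsWith peaksOddValleysEven? (4 + m)
  , length-<-retraction encode decode (PermsWith-unique _ (4 + m))
      (decode-encode (4 + m)) (encode-∈-Aperms m) (witness-∈-Aperms m) (encode≢witness (4 + m))
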